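{- Every graph in the family $\mathcal{G}_{sc}$ that is not a $2$-tree has a NAC-colouring.
   Context: The family $\mathcal{G}_{sc}$ is defined recursively: the single edge $K_2$ belongs to $\mathcal{G}_{sc}$; and if $G_1\in\mathcal{G}_{sc}$ and $G_2$ is a $3$-cycle or a $3$-prism (the graph consisting of two vertex-disjoint triangles $a_1a_2a_3$, $b_1b_2b_3$ together with the edges $a_ib_i$, $i=1,2,3$), then any graph obtained by gluing $G_1$ and $G_2$ along an edge or along a $3$-cycle (identifying an edge, resp. a $3$-cycle, of $G_1$ with one of $G_2$) belongs to $\mathcal{G}_{sc}$. A $2$-tree is a graph obtained from a single edge by repeatedly adding a new vertex adjacent to exactly the two endpoints of an existing edge (a single edge is a $2$-tree). A NAC-colouring of a graph $G$ is a surjective map $c\colon E(G)\to\{\mathrm{red},\mathrm{blue}\}$ such that every cycle of $G$ is either monochromatic or contains at least two red and at least two blue edges. -}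

module Defs where

open import Data.Nat as ℕ using (ℕ; zero; suc; _<ᵇ_; _≡ᵇ_; _+_)
open import Data.Nat.DivMod using (_%_; m%n<n)
open import Data.Bool using (Bool; true; false; not; _∧_; _∨_; if_then_else_)
open import Data.Bool.Properties using () renaming (_≟_ to _≟B_)
open import Data.Fin as Fin using (Fin; toℕ; fromℕ<)
open import Data.Fin.Properties using (all?)
open import Data.Product using (Σ; ∃; ∃-syntax; _×_; _,_)
open import Data.Sum using (_⊎_)
open import Data.Empty using (⊥)
open import Function.Bundles using (_⇔_)
open import Function.Definitions using (Injective; Bijective)
open import Relation.Nullary using (¬_; yes; no)
open import Relation.Nullary.Decidable using (toWitness)
open import Relation.Binary.PropositionalEquality using (_≡_; _≢_; refl)

record Graph : Set where
  field
    n     : ℕ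
    adj   : Fin n → Fin n → Bool
    sym   : ∀ u v → adj u v ≡ adj v u
    irr   : ∀ u → adj u u ≡ false

open Graph public

V : Graph → Set
V G = Fin (n G)

Edge : (G : Graph) → V G → V G → Set
Edge G u v = adj G u v ≡ true

private
  neqᵇ : ∀ {m} → Fin m → Fin m → Bool
  neqᵇ u v = not (toℕ u ≡ᵇ toℕ v)

  -- adjacency of the prism on Fin 6: vertices 0,1,2 = a₁a₂a₃,
  -- vertices 3,4,5 = b₁b₂b₃, with aᵢ ~ bᵢ.
  prismAdj : Fin 6 → Fin 6 → Bool
  prismAdj u v =
    let i = toℕ u ; j = toℕ v in
    ((i <ᵇ 3) ∧ (j <ᵇ 3) ∧ not (i ≡ᵇ j))
    ∨ ((2 <ᵇ i) ∧ (2 <ᵇ j) ∧ not (i ≡ᵇ j))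
    ∨ ((i + 3) ≡ᵇ j) ∨ ((j + 3) ≡ᵇ i)

K₂ : Graph
K₂ = record
  { n = 2 ; adj = neqᵇ
  ; sym = toWitness {a? = all? λ u → all? λ v → neqᵇ {2} u v ≟B neqᵇ v u} _
  ; irr = toWitness {a? = all? λ u → neqᵇ {2} u u ≟B false} _ }

K₃ : Graph
K₃ = record
  { n = 3 ; adj = neqᵇ
  ; sym = toWitness {a? = all? λ u → all? λ v → neqᵇ {3} u v ≟B neqᵇ v u} _
  ; irr = toWitness {a? = all? λ u → neqᵇ {3} u u ≟B false} _ }

Prism : Graph
Prism = record
  { n = 6 ; adj = prismAdj
  ; sym = toWitness {a? = all? λ u → all? λ v → prismAdj u v ≟B prismAdj v u} _
  ; irr = toWitness {a? = all? λ u → prismAdj u u ≟B false} _ }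

_≅_ : Graph → Graph → Set
G ≅ H = Σ (V G → V H) λ f → Bijective _≡_ _≡_ f × (∀ u v → adj H (f u) (f v) ≡ adj G u v)

-- Gluing.  `Glue k G₁ G₂ G` : G is obtained from G₁ and G₂ by identifying
-- a k-clique of G₁ with a k-clique of G₂ (k = 2: an edge, k = 3: a
-- 3-cycle).

IsClique : (G : Graph) {k : ℕ} → (Fin k → V G) → Set
IsClique G {k} a = Injective _≡_ _≡_ a × (∀ i j → i ≢ j → Edge G (a i) (a j))

Glue : ℕ → Graph → Graph → Graph → Set
Glue k G₁ G₂ G =
  Σ (V G₁ → V G) λ f₁ → Σ (V G₂ → V G) λ f₂ →
  Σ (Fin k → V G₁) λ a₁ → Σ (Fin k → V G₂) λ a₂ →
    Injective _≡_ _≡_ f₁ × Injective _≡_ _≡_ f₂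
  × IsClique G₁ a₁ × IsClique G₂ a₂
  × (∀ i → f₁ (a₁ i) ≡ f₂ (a₂ i))
  × (∀ x → ((∃[ u ] f₁ u ≡ x) × (∃[ w ] f₂ w ≡ x)) ⇔ (∃[ i ] f₁ (a₁ i) ≡ x))
  × (∀ x → (∃[ u ] f₁ u ≡ x) ⊎ (∃[ w ] f₂ w ≡ x))
  × (∀ x y → Edge G x y ⇔
        ((∃[ u ] ∃[ v ] (f₁ u ≡ x × f₁ v ≡ y × Edge G₁ u v))
       ⊎ (∃[ u ] ∃[ v ] (f₂ u ≡ x × f₂ v ≡ y × Edge G₂ u v))))

data InGsc : Graph → Set where
  base : ∀ {G} → G ≅ K₂ → InGsc G
  glue : ∀ {G₁ G₂ G k} → InGsc G₁ → (G₂ ≡ K₃ ⊎ G₂ ≡ Prism)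
       → (k ≡ 2 ⊎ k ≡ 3) → Glue k G₁ G₂ G → InGsc G

AddVertex : Graph → Graph → Set
AddVertex H G =
  Σ (V H → V G) λ f → Σ (V G) λ w → Σ (V H) λ x → Σ (V H) λ y →
    Injective _≡_ _≡_ f
  × (∀ u → f u ≢ w)
  × (∀ z → z ≡ w ⊎ (∃[ u ] f u ≡ z))
  × (∀ u v → adj G (f u) (f v) ≡ adj H u v)
  × Edge H x y
  × (∀ z → Edge G w z ⇔ (z ≡ f x ⊎ z ≡ f y))

data TwoTree : Graph → Set where
  base : ∀ {G} → G ≅ K₂ → TwoTree G
  step : ∀ {H G} → TwoTree H → AddVertex H G → TwoTree G

-- A colouring assigns a colour (true = red,
-- false = blue) to each edge; it is given as a function on ordered vertex
-- pairs which is symmetric on edges (values on non-edges are irrelevant).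

Colour : Set
Colour = Bool

next : ∀ {k} → Fin (suc k) → Fin (suc k)
next {k} i = fromℕ< (m%n<n (suc (toℕ i)) (suc k))

record Cycle (G : Graph) : Set where
  field
    m     : ℕ
    vtx   : Fin (suc (suc (suc m))) → V G
    inj   : Injective _≡_ _≡_ vtx
    edges : ∀ i → Edge G (vtx i) (vtx (next i))

IsNAC : (G : Graph) → (V G → V G → Colour) → Set
IsNAC G c =
    (∀ u v → Edge G u v → c u v ≡ c v u)
  × (∃[ u ] ∃[ v ] (Edge G u v × c u v ≡ true))
  × (∃[ u ] ∃[ v ] (Edge G u v × c u v ≡ false))
  × (∀ (C : Cycle G) → let open Cycle C ; col = λ i → c (vtx i) (vtx (next i)) in
        (∀ i j → col i ≡ col j)
      ⊎ ((∃[ i ] ∃[ j ] (i ≢ j × col i ≡ true × col j ≡ true))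
       × (∃[ i ] ∃[ j ] (i ≢ j × col i ≡ false × col j ≡ false))))

HasNAC : Graph → Set
HasNAC G = ∃[ c ] IsNAC G c

-- A colouring is NAC as soon as, for each colour b, some labelling of the vertices is constant
-- along b-edges and separates the ends of every other edge: on a cycle with a single b-edge, the
-- labelling for the other colour is constant along the remaining edges, hence equal at the two
-- ends of that edge.
-- Such labelled colourings extend over a gluing along an edge or a triangle, since a triangle is
-- monochromatic: give every new edge the colour of the glued clique. So, by induction along the
-- construction of G, either G has one (a glued prism supplies the first: triangles red, rungs
-- blue), or G arises from K₂ by gluing triangles only; then G is a 2-tree, because gluing a
-- triangle along an edge adds a vertex of degree two and gluing it along a triangle adds nothing.

module Submission where

open import Defs hiding (n) renaming (sym to adj-sym)
open import Data.Nat as ℕ using (ℕ; zero; suc; _+_; _≤_; _<_; _≤′_; ≤′-refl; ≤′-step; z≤n; _<ᵇ_)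
open import Data.Nat.Properties using (≤-refl; ≤′⇒≤; ≤⇒≤′; <-trans; <⇒≢; >⇒≢; m<n⇒m<1+n; ≡ᵇ⇒≡)
open import Data.Nat.DivMod using (_mod_; m%n<n; m<n⇒m%n≡m; n%n≡0)
open import Data.Bool using (Bool; true; false; not; _xor_; if_then_else_)
open import Data.Bool.Properties using (not-¬; ¬-not; T-≡) renaming (_≟_ to _≟ᴮ_)
open import Data.Fin as Fin using (Fin; zero; suc; toℕ; fromℕ<; _↑ˡ_)
open import Data.Fin.Properties
  using (all?; any?; toℕ<n; toℕ-fromℕ<; fromℕ<-cong; fromℕ<-toℕ; toℕ-injective; 0≢1+n; suc-injective)
  renaming (_≟_ to _≟ᶠ_)
open import Data.Product as Product using (∃; ∃-syntax; _×_; _,_; proj₁; proj₂)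
open import Data.Sum as Sum using (_⊎_; inj₁; inj₂; [_,_]′)
open import Data.Empty using (⊥-elim)
open import Function using (_∘_; id; const)
open import Function.Bundles using (_⇔_; mk⇔; Equivalence)
open import Function.Definitions using (Injective)
open import Function.Consequences.Propositional using (strictlySurjective⇒surjective)
open import Function.Construct.Composition using (_⇔-∘_)
import Function.Construct.Composition as Compose
import Function.Construct.Symmetry as Inverse
open import Relation.Nullary using (¬_; Dec; yes; no)
open import Relation.Nullary.Decidable using (toWitness; ¬?; _×-dec_; _⊎-dec_; _→-dec_)
open import Relation.Binary.PropositionalEquality

open Equivalence using (to; from)

≡-by-steps : ∀ {X : Set} (h : ℕ → X) {a b} →
             (∀ t → a ≤ t → t < b → h t ≡ h (suc t)) → a ≤′ b → h a ≡ h b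
≡-by-steps h link ≤′-refl = refl
≡-by-steps h link (≤′-step a≤′b) =
  trans (≡-by-steps h (λ t a≤t t<b → link t a≤t (m<n⇒m<1+n t<b)) a≤′b)
        (link _ (≤′⇒≤ a≤′b) ≤-refl)

cycle-closes : ∀ {X : Set} {m} (g : Fin (suc m) → X) (j : Fin (suc m)) →
               (∀ i → i ≢ j → g i ≡ g (next i)) → g j ≡ g (next j)
cycle-closes {X} {m} g j ≡next = begin
  g j              ≡⟨ sym (h-toℕ j) ⟩
  h (toℕ j)        ≡⟨ sym (≡-by-steps h (λ t _ t<j → h-step t (<-trans t<j (toℕ<n j)) (<⇒≢ t<j))
                                         (≤⇒≤′ z≤n)) ⟩
  h 0              ≡⟨ cong g (fromℕ<-cong 0 (N ℕ.% N) (sym (n%n≡0 N)) (m%n<n 0 N) (m%n<n N N)) ⟩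
  h N              ≡⟨ sym (≡-by-steps h (λ t j<t t<N → h-step t t<N (>⇒≢ j<t)) (≤⇒≤′ (toℕ<n j))) ⟩
  g (next j)       ∎
  where
  open ≡-Reasoning
  N : ℕ
  N = suc m
  -- g read periodically on ℕ; then g (next j) is h (suc (toℕ j)) by definition
  h : ℕ → X
  h t = g (t mod N)
  h-toℕ : ∀ i → h (toℕ i) ≡ g i
  h-toℕ i = cong g (trans (fromℕ<-cong _ _ (m<n⇒m%n≡m (toℕ<n i)) _ (toℕ<n i)) (fromℕ<-toℕ i _))
  h-step : ∀ t → t < N → t ≢ toℕ j → h t ≡ h (suc t)
  h-step t t<N t≢j = begin
    h t                ≡⟨ cong h (sym (toℕ-fromℕ< t<N)) ⟩
    h (toℕ i)          ≡⟨ h-toℕ i ⟩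
    g i                ≡⟨ ≡next i (t≢j ∘ trans (sym (toℕ-fromℕ< t<N)) ∘ cong toℕ) ⟩
    h (suc (toℕ i))    ≡⟨ cong (h ∘ suc) (toℕ-fromℕ< t<N) ⟩
    h (suc t)          ∎
    where i = fromℕ< t<N

IsComponentLabelling : (G : Graph) → (V G → V G → Colour) → Colour → (V G → V G) → Set
IsComponentLabelling G c b L = ∀ {u v} → Edge G u v → (c u v ≡ b ⇔ L u ≡ L v)

record IsLabelledNAC (G : Graph) (c : V G → V G → Colour) : Set where
  field
    symmetric     : ∀ u v → Edge G u v → c u v ≡ c v u
    red-edge      : ∃[ u ] ∃[ v ] (Edge G u v × c u v ≡ true)
    blue-edge     : ∃[ u ] ∃[ v ] (Edge G u v × c u v ≡ false)
    label         : Colour → V G → V G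
    label-correct : ∀ b → IsComponentLabelling G c b (label b)

HasLabelledNAC : Graph → Set
HasLabelledNAC G = ∃ (IsLabelledNAC G)

TwoEdgesColoured : ∀ {k} → (Fin k → Colour) → Colour → Set
TwoEdgesColoured colour b = ∃[ i ] ∃[ j ] (i ≢ j × colour i ≡ b × colour j ≡ b)

module _ {G : Graph} {c : V G → V G → Colour} (nac : IsLabelledNAC G c) (C : Cycle G) where
  open IsLabelledNAC nac
  open Cycle C

  colour : Fin (suc (suc (suc m))) → Colour
  colour i = c (vtx i) (vtx (next i))

  no-lonely-edge : ∀ b i → colour i ≡ b → ∃[ j ] (j ≢ i × colour j ≡ b)
  no-lonely-edge b i colour-i with any? (λ j → ¬? (j ≟ᶠ i) ×-dec (colour j ≟ᴮ b))
  ... | yes (j , j≢i , colour-j) = j , j≢i , colour-j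
  ... | no ∄j = ⊥-elim (not-¬ colour-i (from (label-correct (not b) (edges i)) link-i))
    where
    link-i : label (not b) (vtx i) ≡ label (not b) (vtx (next i))
    link-i = cycle-closes (label (not b) ∘ vtx) i λ j j≢i →
      to (label-correct (not b) (edges j)) (¬-not λ colour-j → ∄j (j , j≢i , colour-j))

  none-or-two : ∀ b → (∀ i → colour i ≢ b) ⊎ TwoEdgesColoured colour b
  none-or-two b with any? (λ i → colour i ≟ᴮ b)
  ... | no ∄i = inj₁ λ i colour-i → ∄i (i , colour-i)
  ... | yes (i , colour-i) with no-lonely-edge b i colour-i
  ...   | j , j≢i , colour-j = inj₂ (i , j , j≢i ∘ sym , colour-i , colour-j)

  monochromatic-or-two-each :
    (∀ i j → colour i ≡ colour j) ⊎ (TwoEdgesColoured colour true × TwoEdgesColoured colour false)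
  monochromatic-or-two-each with none-or-two true | none-or-two false
  ... | inj₁ no-red | _ = inj₁ λ i j → trans (¬-not (no-red i)) (sym (¬-not (no-red j)))
  ... | inj₂ _ | inj₁ no-blue = inj₁ λ i j → trans (¬-not (no-blue i)) (sym (¬-not (no-blue j)))
  ... | inj₂ two-red | inj₂ two-blue = inj₂ (two-red , two-blue)

labelledNAC⇒NAC : ∀ {G c} → IsLabelledNAC G c → IsNAC G c
labelledNAC⇒NAC nac = symmetric , red-edge , blue-edge , monochromatic-or-two-each nac
  where open IsLabelledNAC nac

edge-irreflexive : ∀ (G : Graph) {x} → ¬ Edge G x x
edge-irreflexive G {x} e with trans (sym e) (irr G x)
... | ()

module _ {G : Graph} {c : V G → V G → Colour} (nac : IsLabelledNAC G c) where
  open IsLabelledNAC nac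

  triangle-one-component : ∀ {x y z} → Edge G x y → Edge G y z → Edge G x z →
                           label (c x y) z ≡ label (c x y) x
  triangle-one-component {x} {y} {z} xy yz xz with c x z ≟ᴮ c x y | c y z ≟ᴮ c x y
  ... | yes xz-same | _ = sym (to (label-correct _ xz) xz-same)
  ... | no _ | yes yz-same = sym (trans (to (label-correct _ xy) refl) (to (label-correct _ yz) yz-same))
  ... | no xz-other | no yz-other = ⊥-elim (not-¬ refl (from (label-correct _ xy) x∼y))
    where
    x∼y : label (not (c x y)) x ≡ label (not (c x y)) y
    x∼y = trans (to (label-correct _ xz) (¬-not xz-other))
                (sym (to (label-correct _ yz) (¬-not yz-other)))

  clique-one-component : ∀ {k} (a : Fin (2 + k) → V G) → (∀ i j → i ≢ j → Edge G (a i) (a j)) →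
                         let b = c (a zero) (a (suc zero)) in ∀ i → label b (a i) ≡ label b (a zero)
  clique-one-component a edge zero = refl
  clique-one-component a edge (suc zero) = sym (to (label-correct _ (edge zero (suc zero) λ ())) refl)
  clique-one-component a edge (suc (suc i)) =
    triangle-one-component (edge zero (suc zero) λ ()) (edge (suc zero) (suc (suc i)) λ ())
                           (edge zero (suc (suc i)) λ ())

record Piece (P G : Graph) (k : ℕ) : Set where
  field
    embed           : V P → V G
    embed-injective : Injective _≡_ _≡_ embed
    clique          : Fin k → V P
    clique-edge     : ∀ i j → i ≢ j → Edge P (clique i) (clique j)
    embed-edge      : ∀ {u v} → Edge P u v → Edge G (embed u) (embed v)
    edge-embed      : ∀ {u v} → Edge G (embed u) (embed v) → Edge P u v
    boundary-clique : ∀ {x u} → Edge G x (embed u) → ¬ (∃[ w ] embed w ≡ x) → ∃[ i ] clique i ≡ u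

≡-from-≡true-⇔ : ∀ {x y : Bool} → (x ≡ true ⇔ y ≡ true) → x ≡ y
≡-from-≡true-⇔ {true}  {true}  _   = refl
≡-from-≡true-⇔ {true}  {false} x⇔y = sym (to x⇔y refl)
≡-from-≡true-⇔ {false} {true}  x⇔y = from x⇔y refl
≡-from-≡true-⇔ {false} {false} _   = refl

piece-adj : ∀ {P G k} (piece : Piece P G k) → let open Piece piece in
            ∀ u v → adj G (embed u) (embed v) ≡ adj P u v
piece-adj piece u v = ≡-from-≡true-⇔ (mk⇔ edge-embed embed-edge)
  where open Piece piece

-- Every edge of G outside the image of P gets the colour b₀ of the clique. The vertices outside
-- the image reach it only through the clique, which lies in a single b₀-component; so for b₀
-- they join that component, and for the other colour they are singletons.
module Extension {P G : Graph} {k} (piece : Piece P G (2 + k))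
                 {c : V P → V P → Colour} (nac : IsLabelledNAC P c) where
  open Piece piece
  open IsLabelledNAC nac

  Outside : V G → Set
  Outside x = ¬ (∃[ u ] embed u ≡ x)

  image? : ∀ x → Dec (∃[ u ] embed u ≡ x)
  image? x = any? λ u → embed u ≟ᶠ x

  -- opaque, so that `with image? x` in the proofs below leaves c⁺ and the labels alone
  opaque
    extendBy : {A : Set} → (V P → A) → (V G → A) → V G → A
    extendBy g h x with image? x
    ... | yes (u , _) = g u
    ... | no _        = h x

    extendBy-embed : ∀ {A : Set} (g : V P → A) h u → extendBy g h (embed u) ≡ g u
    extendBy-embed g h u with image? (embed u)
    ... | yes (w , embed-w≡embed-u) = cong g (embed-injective embed-w≡embed-u)
    ... | no u-outside              = ⊥-elim (u-outside (u , refl))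

    extendBy-outside : ∀ {A : Set} (g : V P → A) h {x} → Outside x → extendBy g h x ≡ h x
    extendBy-outside g h {x} x-outside with image? x
    ... | yes u,x = ⊥-elim (x-outside u,x)
    ... | no _    = refl

  b₀ : Colour
  b₀ = c (clique zero) (clique (suc zero))

  c⁺ : V G → V G → Colour
  c⁺ x y = extendBy (λ u → extendBy (c u) (const b₀) y) (const b₀) x

  c⁺-embed : ∀ u v → c⁺ (embed u) (embed v) ≡ c u v
  c⁺-embed u v = trans (extendBy-embed _ _ u) (extendBy-embed (c u) _ v)

  c⁺-outsideˡ : ∀ {x} y → Outside x → c⁺ x y ≡ b₀
  c⁺-outsideˡ y x-outside = extendBy-outside _ _ x-outside

  c⁺-outsideʳ : ∀ x {y} → Outside y → c⁺ x y ≡ b₀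
  c⁺-outsideʳ x y-outside with image? x
  ... | yes (u , refl) = trans (extendBy-embed _ _ u) (extendBy-outside (c u) _ y-outside)
  ... | no x-outside   = c⁺-outsideˡ _ x-outside

  c⁺-symmetric : ∀ x y → Edge G x y → c⁺ x y ≡ c⁺ y x
  c⁺-symmetric x y e with image? x | image? y
  ... | yes (u , refl) | yes (v , refl) =
    trans (c⁺-embed u v) (trans (symmetric u v (edge-embed e)) (sym (c⁺-embed v u)))
  ... | no x-outside | _ = trans (c⁺-outsideˡ y x-outside) (sym (c⁺-outsideʳ y x-outside))
  ... | yes _ | no y-outside = trans (c⁺-outsideʳ x y-outside) (sym (c⁺-outsideˡ x y-outside))

  label-same : V G → V G
  label-same = extendBy (embed ∘ label b₀) (const (embed (label b₀ (clique zero))))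

  label-other : Colour → V G → V G
  label-other b = extendBy (embed ∘ label b) id

  label⁺ : Colour → V G → V G
  label⁺ b with b ≟ᴮ b₀
  ... | yes _ = label-same
  ... | no _  = label-other b

  inside-correct : ∀ b (L : V G → V G) → (∀ u → L (embed u) ≡ embed (label b u)) →
                   ∀ {u v} → Edge G (embed u) (embed v) →
                   (c⁺ (embed u) (embed v) ≡ b ⇔ L (embed u) ≡ L (embed v))
  inside-correct b L L-embed {u} {v} e
    rewrite c⁺-embed u v | L-embed u | L-embed v =
    mk⇔ (cong embed) embed-injective ⇔-∘ label-correct b (edge-embed e)

  label-same-outside : ∀ {x y} → Edge G x y → Outside x → label-same x ≡ label-same y
  label-same-outside {x} {y} e x-outside with image? y
  ... | no y-outside   = trans (extendBy-outside _ _ x-outside) (sym (extendBy-outside _ _ y-outside))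
  ... | yes (v , refl) with boundary-clique e x-outside
  ...   | i , refl = begin
    label-same x                         ≡⟨ extendBy-outside _ _ x-outside ⟩
    embed (label b₀ (clique zero))        ≡⟨ cong embed (sym (clique-one-component nac clique clique-edge i)) ⟩
    embed (label b₀ (clique i))           ≡⟨ sym (extendBy-embed _ _ (clique i)) ⟩
    label-same (embed (clique i))        ∎
    where open ≡-Reasoning

  label-other-outside : ∀ b {x y} → Edge G x y → Outside x → label-other b x ≢ label-other b y
  label-other-outside b {x} {y} e x-outside x∼y with image? y
  ... | no y-outside = edge-irreflexive G (subst (Edge G x) (sym x≡y) e)
    where
    x≡y : x ≡ y
    x≡y = trans (sym (extendBy-outside _ _ x-outside)) (trans x∼y (extendBy-outside _ _ y-outside))
  ... | yes (v , refl) =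
    x-outside (label b v , sym (trans (sym (extendBy-outside _ _ x-outside))
                                      (trans x∼y (extendBy-embed _ _ v))))

  outside-correct : ∀ b {x y} → Edge G x y → Outside x → (c⁺ x y ≡ b ⇔ label⁺ b x ≡ label⁺ b y)
  outside-correct b e x-outside with b ≟ᴮ b₀
  ... | yes refl = mk⇔ (λ _ → label-same-outside e x-outside) (λ _ → c⁺-outsideˡ _ x-outside)
  ... | no b≢b₀  = mk⇔ (λ c⁺≡b → ⊥-elim (b≢b₀ (trans (sym c⁺≡b) (c⁺-outsideˡ _ x-outside))))
                       (⊥-elim ∘ label-other-outside b e x-outside)

  label⁺-correct : ∀ b → IsComponentLabelling G c⁺ b (label⁺ b)
  label⁺-correct b {x} {y} e with image? x | image? y
  ... | yes (u , refl) | yes (v , refl) = inside-correct b (label⁺ b) label⁺-embed e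
    where
    label⁺-embed : ∀ u → label⁺ b (embed u) ≡ embed (label b u)
    label⁺-embed u with b ≟ᴮ b₀
    ... | yes refl = extendBy-embed _ _ u
    ... | no _     = extendBy-embed _ _ u
  ... | no x-outside | _ = outside-correct b e x-outside
  ... | yes _ | no y-outside = mk⇔
    (λ c⁺≡b → sym (to flipped (trans (c⁺-symmetric y x e′) c⁺≡b)))
    (λ x∼y → trans (c⁺-symmetric x y e) (from flipped (sym x∼y)))
    where
    e′ : Edge G y x
    e′ = trans (adj-sym G y x) e
    flipped : c⁺ y x ≡ b ⇔ label⁺ b y ≡ label⁺ b x
    flipped = outside-correct b e′ y-outside

  extension : IsLabelledNAC G c⁺
  extension = record
    { symmetric     = c⁺-symmetric
    ; red-edge      = lift-edge red-edge
    ; blue-edge     = lift-edge blue-edge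
    ; label         = label⁺
    ; label-correct = label⁺-correct
    }
    where
    lift-edge : ∀ {b} → ∃[ u ] ∃[ v ] (Edge P u v × c u v ≡ b) →
                ∃[ x ] ∃[ y ] (Edge G x y × c⁺ x y ≡ b)
    lift-edge (u , v , e , c≡b) = embed u , embed v , embed-edge e , trans (c⁺-embed u v) c≡b

glue-swap : ∀ {k G₁ G₂ G} → Glue k G₁ G₂ G → Glue k G₂ G₁ G
glue-swap {k} {G₁} {G₂} {G}
  (f₁ , f₂ , a₁ , a₂ , f₁-inj , f₂-inj , clq₁ , clq₂ , glued , meet , cover , edges) =
  f₂ , f₁ , a₂ , a₁ , f₂-inj , f₁-inj , clq₂ , clq₁ , sym ∘ glued , meet′ , Sum.swap ∘ cover ,
  λ x y → mk⇔ (Sum.swap ∘ to (edges x y)) (from (edges x y) ∘ Sum.swap)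
  where
  meet′ : ∀ x → ((∃[ w ] f₂ w ≡ x) × (∃[ u ] f₁ u ≡ x)) ⇔ (∃[ i ] f₂ (a₂ i) ≡ x)
  meet′ x = mk⇔
    (λ in-both → Product.map₂ (trans (sym (glued _))) (to (meet x) (Product.swap in-both)))
    (λ (i , p) → Product.swap (from (meet x) (i , trans (glued i) p)))

glue-piece : ∀ {k G₁ G₂ G} → Glue k G₁ G₂ G → Piece G₁ G k
glue-piece {k} {G₁} {G₂} {G}
  (f₁ , f₂ , a₁ , a₂ , f₁-inj , f₂-inj , clq₁ , clq₂ , glued , meet , cover , edges) = record
  { embed           = f₁
  ; embed-injective = f₁-inj
  ; clique          = a₁
  ; clique-edge     = proj₂ clq₁
  ; embed-edge      = λ {u} {v} e → from (edges (f₁ u) (f₁ v)) (inj₁ (u , v , refl , refl , e))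
  ; edge-embed      = edge-embed
  ; boundary-clique = boundary-clique
  }
  where
  in-clique : ∀ {u w} → f₂ w ≡ f₁ u → ∃[ i ] a₁ i ≡ u
  in-clique {u} {w} p = Product.map₂ f₁-inj (to (meet (f₁ u)) ((u , refl) , (w , p)))

  edge-embed : ∀ {u v} → Edge G (f₁ u) (f₁ v) → Edge G₁ u v
  edge-embed {u} {v} e with to (edges (f₁ u) (f₁ v)) e
  ... | inj₁ (u′ , v′ , p , q , e′) = subst₂ (Edge G₁) (f₁-inj p) (f₁-inj q) e′
  ... | inj₂ (u′ , v′ , p , q , e′) with in-clique p | in-clique q
  ...   | i , refl | j , refl = proj₂ clq₁ i j λ { refl → edge-irreflexive G e }

  boundary-clique : ∀ {x u} → Edge G x (f₁ u) → ¬ (∃[ w ] f₁ w ≡ x) → ∃[ i ] a₁ i ≡ u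
  boundary-clique {x} {u} e x-outside with to (edges x (f₁ u)) e
  ... | inj₁ (u′ , _ , p , _) = ⊥-elim (x-outside (u′ , p))
  ... | inj₂ (_ , _ , _ , q , _) = in-clique q

labelledNAC-extends : ∀ {k P G} → k ≡ 2 ⊎ k ≡ 3 → Piece P G k → HasLabelledNAC P → HasLabelledNAC G
labelledNAC-extends (inj₁ refl) piece (_ , nac) = _ , Extension.extension piece nac
labelledNAC-extends (inj₂ refl) piece (_ , nac) = _ , Extension.extension piece nac

-- Triangles red, rungs blue; the labels name the triangle, resp. the rung, of a vertex.
in-triangle-a : Fin 6 → Bool
in-triangle-a u = toℕ u <ᵇ 3

prism-colour : Fin 6 → Fin 6 → Colour
prism-colour u v = not (in-triangle-a u xor in-triangle-a v)

prism-label : Colour → Fin 6 → Fin 6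
prism-label true  u = if in-triangle-a u then zero else suc zero
prism-label false u = (toℕ u mod 3) ↑ˡ 3

prism-labelledNAC : HasLabelledNAC Prism
prism-labelledNAC = prism-colour , record
  { symmetric     = toWitness {a? = all? λ u → all? λ v →
                      (adj Prism u v ≟ᴮ true) →-dec (prism-colour u v ≟ᴮ prism-colour v u)} _
  ; red-edge      = zero , suc zero , refl , refl
  ; blue-edge     = zero , suc (suc (suc zero)) , refl , refl
  ; label         = prism-label
  ; label-correct = λ b {u} {v} e → let (⇒ , ⇐) = correct b u v e in mk⇔ ⇒ ⇐
  }
  where
  Correct : Colour → Set
  Correct b = ∀ u v → Edge Prism u v →
    (prism-colour u v ≡ b → prism-label b u ≡ prism-label b v) ×
    (prism-label b u ≡ prism-label b v → prism-colour u v ≡ b)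
  correct? : ∀ b → Dec (Correct b)
  correct? b = all? λ u → all? λ v → (adj Prism u v ≟ᴮ true) →-dec
    ((prism-colour u v ≟ᴮ b →-dec prism-label b u ≟ᶠ prism-label b v) ×-dec
     (prism-label b u ≟ᶠ prism-label b v →-dec prism-colour u v ≟ᴮ b))
  correct : ∀ b → Correct b
  correct true  = toWitness {a? = correct? true} _
  correct false = toWitness {a? = correct? false} _

≅-trans : ∀ {G H K} → G ≅ H → H ≅ K → G ≅ K
≅-trans (f , f-bijective , f-adj) (g , g-bijective , g-adj) =
  g ∘ f , Compose.bijective _≡_ _≡_ _≡_ f-bijective g-bijective ,
  λ u v → trans (g-adj (f u) (f v)) (f-adj u v)

≅-sym : ∀ {G H} → G ≅ H → H ≅ G
≅-sym {G} {H} (f , f-bijective , f-adj) =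
  f⁻¹ , Inverse.bijective f-bijective refl sym trans (cong f) , f⁻¹-adj
  where
  f⁻¹ : V H → V G
  f⁻¹ x = proj₁ (proj₂ f-bijective x)
  f∘f⁻¹ : ∀ x → f (f⁻¹ x) ≡ x
  f∘f⁻¹ x = proj₂ (proj₂ f-bijective x) refl
  f⁻¹-adj : ∀ x y → adj G (f⁻¹ x) (f⁻¹ y) ≡ adj H x y
  f⁻¹-adj x y = trans (sym (f-adj (f⁻¹ x) (f⁻¹ y))) (cong₂ (adj H) (f∘f⁻¹ x) (f∘f⁻¹ y))

AddVertex-≅ : ∀ {H G G′} → AddVertex H G → G ≅ G′ → AddVertex H G′
AddVertex-≅ {H} {G} {G′} (f , w , x , y , f-inj , f≢w , covers , f-adj , xy , w-nbrs)
                         (g , (g-inj , g-surj) , g-adj) =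
  g ∘ f , g w , x , y , f-inj ∘ g-inj , (λ u → f≢w u ∘ g-inj) , covers′ ,
  (λ u v → trans (g-adj (f u) (f v)) (f-adj u v)) , xy , w-nbrs′
  where
  g-onto : ∀ z → ∃[ z′ ] g z′ ≡ z
  g-onto z = Product.map₂ (λ p → p refl) (g-surj z)

  covers′ : ∀ z → z ≡ g w ⊎ ∃[ u ] g (f u) ≡ z
  covers′ z with g-onto z
  ... | z′ , refl = Sum.map (cong g) (Product.map₂ (cong g)) (covers z′)

  w-nbrs′ : ∀ z → Edge G′ (g w) z ⇔ (z ≡ g (f x) ⊎ z ≡ g (f y))
  w-nbrs′ z with g-onto z
  ... | z′ , refl = mk⇔ (Sum.map (cong g) (cong g)) (Sum.map g-inj g-inj)
                    ⇔-∘ (w-nbrs z′ ⇔-∘ mk⇔ (trans (sym (g-adj w z′))) (trans (g-adj w z′)))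

TwoTree-≅ : ∀ {G G′} → G ≅ G′ → TwoTree G → TwoTree G′
TwoTree-≅ {G} {G′} G≅G′ (base G≅K₂)          = base (≅-trans {G′} {G} {K₂} (≅-sym {G} {G′} G≅G′) G≅K₂)
TwoTree-≅ {G} {G′} G≅G′ (step {H} tree H+w≡G) = step tree (AddVertex-≅ {H} {G} {G′} H+w≡G G≅G′)

ThirdVertex : Fin 3 → Fin 3 → Set
ThirdVertex p q = ∃[ t ] (t ≢ p × t ≢ q × ∀ s → s ≡ t ⊎ s ≡ p ⊎ s ≡ q)

third-vertex : ∀ {p q} → p ≢ q → ThirdVertex p q
third-vertex {p} {q} p≢q = [ ⊥-elim ∘ p≢q , id ]′ (toWitness {a? = decided} _ p q)
  where
  decided : Dec (∀ p q → p ≡ q ⊎ ThirdVertex p q)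
  decided = all? λ p → all? λ q → (p ≟ᶠ q) ⊎-dec any? λ t → ¬? (t ≟ᶠ p) ×-dec ¬? (t ≟ᶠ q) ×-dec
              all? λ s → (s ≟ᶠ t) ⊎-dec (s ≟ᶠ p) ⊎-dec (s ≟ᶠ q)

K₃-edge : ∀ {u v : Fin 3} → u ≢ v → Edge K₃ u v
K₃-edge {u} {v} u≢v = cong not (¬-not (u≢v ∘ toℕ-injective ∘ ≡ᵇ⇒≡ (toℕ u) (toℕ v) ∘ from T-≡))

injective-Fin3-onto : (a : Fin 3 → Fin 3) → Injective _≡_ _≡_ a → ∀ s → ∃[ i ] a i ≡ s
injective-Fin3-onto a a-inj s with third-vertex {a zero} {a (suc zero)} (0≢1+n ∘ a-inj)
... | t , t≢a0 , t≢a1 , vertices with vertices s | vertices (a (suc (suc zero)))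
...   | inj₂ (inj₁ refl) | _ = zero , refl
...   | inj₂ (inj₂ refl) | _ = suc zero , refl
...   | inj₁ refl | inj₁ a2≡t = suc (suc zero) , a2≡t
...   | inj₁ refl | inj₂ (inj₁ a2≡a0) = ⊥-elim (0≢1+n (sym (a-inj a2≡a0)))
...   | inj₁ refl | inj₂ (inj₂ a2≡a1) = ⊥-elim (0≢1+n (suc-injective (sym (a-inj a2≡a1))))

glue-K₃-triangle : ∀ {G₁ G} → Glue 3 G₁ K₃ G → G₁ ≅ G
glue-K₃-triangle {G₁} {G}
  gl@(f₁ , f₂ , a₁ , a₂ , f₁-inj , f₂-inj , clq₁ , clq₂ , glued , meet , cover , edges) =
  f₁ , (f₁-inj , strictlySurjective⇒surjective onto) , piece-adj (glue-piece {3} {G₁} {K₃} {G} gl)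
  where
  onto : ∀ z → ∃[ u ] f₁ u ≡ z
  onto z with cover z
  ... | inj₁ in-G₁ = in-G₁
  ... | inj₂ (s , refl) with injective-Fin3-onto a₂ (proj₁ clq₂) s
  ...   | i , refl = a₁ i , glued i

glue-K₃-edge : ∀ {G₁ G} → Glue 2 G₁ K₃ G → AddVertex G₁ G
glue-K₃-edge {G₁} {G}
  gl@(f₁ , f₂ , a₁ , a₂ , f₁-inj , f₂-inj , clq₁ , clq₂ , glued , meet , cover , edges)
  with third-vertex {a₂ zero} {a₂ (suc zero)} (0≢1+n ∘ proj₁ clq₂)
... | t , t≢a₂0 , t≢a₂1 , K₃-vertices =
  f₁ , f₂ t , a₁ zero , a₁ (suc zero) , f₁-inj , new , covers , piece-adj (glue-piece {2} {G₁} {K₃} {G} gl) ,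
  proj₂ clq₁ zero (suc zero) (λ ()) , t-neighbours
  where
  new : ∀ u → f₁ u ≢ f₂ t
  new u p with to (meet (f₂ t)) ((u , p) , (t , refl))
  ... | zero     , q = t≢a₂0 (sym (f₂-inj (trans (sym (glued zero)) q)))
  ... | suc zero , q = t≢a₂1 (sym (f₂-inj (trans (sym (glued (suc zero))) q)))

  covers : ∀ z → z ≡ f₂ t ⊎ ∃[ u ] f₁ u ≡ z
  covers z with cover z
  ... | inj₁ in-G₁ = inj₂ in-G₁
  ... | inj₂ (s , refl) with K₃-vertices s
  ...   | inj₁ refl        = inj₁ refl
  ...   | inj₂ (inj₁ refl) = inj₂ (a₁ zero , glued zero)
  ...   | inj₂ (inj₂ refl) = inj₂ (a₁ (suc zero) , glued (suc zero))

  t-neighbours : ∀ z → Edge G (f₂ t) z ⇔ (z ≡ f₁ (a₁ zero) ⊎ z ≡ f₁ (a₁ (suc zero)))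
  t-neighbours z = mk⇔ ⇒ ⇐
    where
    ⇒ : Edge G (f₂ t) z → z ≡ f₁ (a₁ zero) ⊎ z ≡ f₁ (a₁ (suc zero))
    ⇒ e with to (edges (f₂ t) z) e
    ... | inj₁ (u , _ , p , _) = ⊥-elim (new u p)
    ... | inj₂ (u , v , p , refl , e′) with f₂-inj p | K₃-vertices v
    ...   | refl | inj₁ refl        = ⊥-elim (edge-irreflexive K₃ {t} e′)
    ...   | refl | inj₂ (inj₁ refl) = inj₁ (sym (glued zero))
    ...   | refl | inj₂ (inj₂ refl) = inj₂ (sym (glued (suc zero)))
    ⇐ : z ≡ f₁ (a₁ zero) ⊎ z ≡ f₁ (a₁ (suc zero)) → Edge G (f₂ t) z
    ⇐ (inj₁ refl) = from (edges _ _) (inj₂ (t , _ , refl , sym (glued zero) , K₃-edge t≢a₂0))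
    ⇐ (inj₂ refl) = from (edges _ _) (inj₂ (t , _ , refl , sym (glued (suc zero)) , K₃-edge t≢a₂1))

twoTree-or-labelledNAC : ∀ {G} → InGsc G → TwoTree G ⊎ HasLabelledNAC G
twoTree-or-labelledNAC (base G≅K₂) = inj₁ (base G≅K₂)
twoTree-or-labelledNAC (glue {G₁} {G₂} {G} {k} G₁∈ shape size gl)
  with twoTree-or-labelledNAC G₁∈ | shape | size
... | inj₂ nac₁ | _         | _         =
  inj₂ (labelledNAC-extends size (glue-piece {k} {G₁} {G₂} {G} gl) nac₁)
... | inj₁ _    | inj₂ refl | _         =
  inj₂ (labelledNAC-extends size (glue-piece {k} {Prism} {G₁} {G} (glue-swap {k} {G₁} {Prism} {G} gl))
                            prism-labelledNAC)
... | inj₁ tree | inj₁ refl | inj₁ refl = inj₁ (step tree (glue-K₃-edge {G₁} {G} gl))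
... | inj₁ tree | inj₁ refl | inj₂ refl = inj₁ (TwoTree-≅ (glue-K₃-triangle {G₁} {G} gl) tree)

proposition3p3 : (G : Graph) → InGsc G → ¬ TwoTree G → HasNAC G
proposition3p3 G G∈ not-tree with twoTree-or-labelledNAC G∈
... | inj₁ tree      = ⊥-elim (not-tree tree)
... | inj₂ (c , nac) = c , labelledNAC⇒NAC nac
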